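{- Let $\sigma$ be a supersequence over a set $A$ of $n$ letters, with segmentation $\sigma_1,\dots,\sigma_n$, and let $\mathbf{n}$ be the last element of $\sigma_1$ (equivalently, the letter of $A$ whose first occurrence in $\sigma$ comes latest). Let $\sigma'$ be the sequence obtained from $\sigma$ by deleting all elements of $\sigma_1$ and all remaining occurrences of $\mathbf{n}$. Then $\sigma'$ is a supersequence over $A\setminus\{\mathbf{n}\}$.
   Context: A supersequence over a finite set $B$ is a finite sequence of letters of $B$ containing every permutation of $B$ as a (not necessarily contiguous) subsequence. A $k$-perm is a sequence of $k$ distinct letters of $A$, and a sequence is $k$-complete if every $k$-perm is a subsequence of it. The segmentation of $\sigma$ is the list of consecutive substrings $\sigma_1,\dots,\sigma_n$ with $\sigma=\sigma_1\cdots\sigma_n$ such that for every $k$ the prefix $\sigma_1\cdots\sigma_k$ is the shortest $k$-complete prefix of $\sigma$. (So $\sigma_1$ is the shortest prefix of $\sigma$ containing every letter of $A$.) -}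

module Defs where

open import Data.Nat using (ℕ; _≤_)
open import Data.Fin using (Fin; _≟_)
open import Data.List using (List; []; _∷_; _++_; length; filter)
open import Data.List.Relation.Unary.Unique.Propositional using (Unique)
open import Data.List.Relation.Binary.Sublist.Propositional using (_⊆_)
open import Data.List.Relation.Binary.Permutation.Propositional using (_↭_)
open import Data.Product using (Σ; _×_)
open import Relation.Binary.PropositionalEquality using (_≡_)
open import Relation.Nullary using (¬?)

Supersequence : {X : Set} → List X → List X → Set
Supersequence {X} B σ = (π : List X) → π ↭ B → π ⊆ σ

KPerm : {n : ℕ} → ℕ → List (Fin n) → Set
KPerm k π = (length π ≡ k) × Unique π

KComplete : {n : ℕ} → ℕ → List (Fin n) → Set
KComplete {n} k τ = (π : List (Fin n)) → KPerm k π → π ⊆ τ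

IsPrefix : {X : Set} → List X → List X → Set
IsPrefix {X} p σ = Σ (List X) (λ r → σ ≡ p ++ r)

ShortestCompletePrefix : {n : ℕ} → ℕ → List (Fin n) → List (Fin n) → Set
ShortestCompletePrefix {n} k σ p =
  IsPrefix p σ × KComplete k p ×
  ((q : List (Fin n)) → IsPrefix q σ → KComplete k q → length p ≤ length q)

deleteAll : {n : ℕ} → Fin n → List (Fin n) → List (Fin n)
deleteAll x = filter (λ y → ¬? (y ≟ x))

{-# OPTIONS --safe #-}

-- The last letter x of σ₁ = p ∷ʳ x does not occur in p: otherwise p would
-- already contain every letter, contradicting the minimality of σ₁. Given a
-- permutation π of A ∖ {x}, the word x ∷ π is a permutation of A and so embeds
-- into σ = p ++ x ∷ rest; since x ∉ p, its first letter is matched no earlier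
-- than the x following p, hence π embeds into rest. As π contains no x, it
-- also embeds into rest with every x deleted.
module Submission where

open import Defs
open import Level using (Level)
open import Data.Nat using (ℕ; _≤_)
open import Data.Nat.Properties using (m+1+n≰m)
open import Data.Fin using (Fin; _≟_)
open import Data.List using (List; []; _∷_; [_]; _++_; _∷ʳ_; allFin; length)
open import Data.List.Properties using (length-++; filter-all; ∷ʳ-++)
open import Data.List.Membership.Propositional using (_∈_; _∉_)
open import Data.List.Membership.Propositional.Properties
  using (∈-allFin; ∈-filter⁻; ∈-++⁻)
open import Data.List.Relation.Unary.Any using (here; there)
open import Data.List.Relation.Unary.All as All using ([]; _∷_)
open import Data.List.Relation.Unary.All.Properties using (All¬⇒¬Any)
open import Data.List.Relation.Unary.AllPairs using ([]; _∷_)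
open import Data.List.Relation.Unary.Unique.Propositional using (Unique)
open import Data.List.Relation.Unary.Unique.Propositional.Properties using (allFin⁺)
open import Data.List.Relation.Binary.Sublist.Propositional using (_⊆_; _∷_; to∈; from∈)
  renaming (_∷ʳ_ to _∷ʳ′_)
open import Data.List.Relation.Binary.Sublist.Propositional.Properties
  using (∷ˡ⁻; filter⁺)
open import Data.List.Relation.Binary.Permutation.Propositional
  using (_↭_; ↭-refl; ↭-reflexive; ↭-trans; prep; swap)
open import Data.List.Relation.Binary.Permutation.Propositional.Properties using (∈-resp-↭)
open import Data.Product using (_,_; proj₂)
open import Data.Sum using (inj₁; inj₂)
open import Function using (id; _∘_)
open import Relation.Nullary using (yes; no; contradiction)
open import Relation.Binary.PropositionalEquality using (_≡_; refl; sym; trans; subst)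

private
  variable
    a : Level
    X : Set a
    n : ℕ

KComplete-1⇒∈ : {τ : List (Fin n)} → KComplete 1 τ → (y : Fin n) → y ∈ τ
KComplete-1⇒∈ complete y = to∈ (complete [ y ] (refl , [] ∷ []))

∈⇒KComplete-1 : {τ : List (Fin n)} → ((y : Fin n) → y ∈ τ) → KComplete 1 τ
∈⇒KComplete-1 ∈τ (y ∷ []) (refl , _) = from∈ (∈τ y)

IsPrefix-∷ʳ⁻ : {p σ : List X} {x : X} → IsPrefix (p ∷ʳ x) σ → IsPrefix p σ
IsPrefix-∷ʳ⁻ {p = p} {x = x} (r , σ≡) = x ∷ r , trans σ≡ (∷ʳ-++ p x r)

shortestCompletePrefix-last∉ : {σ p : List (Fin n)} {x : Fin n} →
                               ShortestCompletePrefix 1 σ (p ∷ʳ x) → x ∉ p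
shortestCompletePrefix-last∉ {p = p} {x} (prefix , complete , shortest) x∈p =
  m+1+n≰m (length p)
    (subst (_≤ length p) (length-++ p) (shortest p (IsPrefix-∷ʳ⁻ prefix) (∈⇒KComplete-1 ∈p)))
  where
  ∈p : ∀ y → y ∈ p
  ∈p y with ∈-++⁻ p (KComplete-1⇒∈ complete y)
  ... | inj₁ y∈p        = y∈p
  ... | inj₂ (here refl) = x∈p

∷⊆++∷⇒⊆ : {x : X} {π p rest : List X} → x ∉ p → x ∷ π ⊆ p ++ x ∷ rest → π ⊆ rest
∷⊆++∷⇒⊆ {p = []}    _   (_ ∷ʳ′ x∷π⊆) = ∷ˡ⁻ x∷π⊆
∷⊆++∷⇒⊆ {p = []}    _   (_ ∷ π⊆)     = π⊆
∷⊆++∷⇒⊆ {p = _ ∷ _} x∉p (_ ∷ʳ′ x∷π⊆) = ∷⊆++∷⇒⊆ (x∉p ∘ there) x∷π⊆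
∷⊆++∷⇒⊆ {p = _ ∷ _} x∉p (refl ∷ _)   = contradiction (here refl) x∉p

deleteAll-∉ : {x : Fin n} {xs : List (Fin n)} → x ∉ xs → deleteAll x xs ≡ xs
deleteAll-∉ x∉xs = filter-all _ (All.tabulate λ y∈xs y≡x → x∉xs (subst (_∈ _) y≡x y∈xs))

deleteAll⁺ : {x : Fin n} {xs ys : List (Fin n)} → xs ⊆ ys → deleteAll x xs ⊆ deleteAll x ys
deleteAll⁺ = filter⁺ _ _ λ { refl → id }

∉-deleteAll : {x : Fin n} (xs : List (Fin n)) → x ∉ deleteAll x xs
∉-deleteAll xs x∈ = proj₂ (∈-filter⁻ _ {xs = xs} x∈) refl

∷-deleteAll-↭ : {x : Fin n} {xs : List (Fin n)} → Unique xs → x ∈ xs → x ∷ deleteAll x xs ↭ xs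
∷-deleteAll-↭ {x = x} {y ∷ xs} (y∉xs ∷ unique) x∈y∷xs with y ≟ x | x∈y∷xs
... | yes refl | _          = prep y (↭-reflexive (deleteAll-∉ (All¬⇒¬Any y∉xs)))
... | no  y≢x  | here x≡y   = contradiction (sym x≡y) y≢x
... | no  _    | there x∈xs = ↭-trans (swap x y ↭-refl) (prep y (∷-deleteAll-↭ unique x∈xs))

lemma3 : (n : ℕ) (σ : List (Fin n)) → Supersequence (allFin n) σ →
         (σ₁ rest p : List (Fin n)) (x : Fin n) →
         ShortestCompletePrefix 1 σ σ₁ → σ ≡ σ₁ ++ rest → σ₁ ≡ p ∷ʳ x →
         Supersequence (deleteAll x (allFin n)) (deleteAll x rest)
lemma3 n _ super _ rest p x shortest refl refl π π↭ =
  subst (_⊆ deleteAll x rest) (deleteAll-∉ x∉π) (deleteAll⁺ π⊆rest)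
  where
  x∷π↭ : x ∷ π ↭ allFin n
  x∷π↭ = ↭-trans (prep x π↭) (∷-deleteAll-↭ (allFin⁺ n) (∈-allFin x))

  π⊆rest : π ⊆ rest
  π⊆rest = ∷⊆++∷⇒⊆ (shortestCompletePrefix-last∉ shortest)
             (subst (x ∷ π ⊆_) (∷ʳ-++ p x rest) (super (x ∷ π) x∷π↭))

  x∉π : x ∉ π
  x∉π = ∉-deleteAll (allFin n) ∘ ∈-resp-↭ π↭
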